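{- If a finite simple graph $G$ contains neither the claw nor the co-diamond as an induced subgraph and $\alpha(G)\ge 4$, then its chromatic symmetric function $X_G$ is $e$-positive.
   Context: $\alpha(G)$ is the maximum size of a stable (independent) set of vertices of $G$. For a finite simple graph $G$ with vertex set $\{v_1,\dots,v_N\}$, $X_G=\sum_{\kappa} x_{\kappa(v_1)}\cdots x_{\kappa(v_N)}$, summed over all proper colorings $\kappa:V\to\mathbb{Z}^+$. A symmetric function is $e$-positive if it is a nonnegative linear combination of elementary symmetric functions $e_\lambda$. The claw is $K_{1,3}$; the co-diamond is the four-vertex graph consisting of one edge and two isolated vertices. -}

module Defs where

open import Data.Bool using (Bool; true; false; if_then_else_; _∧_; _∨_; not)
open import Data.Nat as ℕ using (ℕ; zero; suc; _≤_; _<_; _≥_; _⊔_)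
open import Data.Fin as Fin using (Fin)
open import Data.Fin.Properties as FinP using ()
open import Data.Vec as Vec using (Vec; []; _∷_; lookup)
open import Data.Vec.Properties using (≡-dec)
open import Data.List as List using (List; []; _∷_; [_]; map; concatMap; filter; length; allFin; foldr)
open import Data.List.Relation.Unary.All using (All)
open import Data.List.Relation.Unary.Linked using (Linked)
open import Data.Product using (_×_; _,_; proj₁; proj₂; ∃)
open import Data.Integer using (+_)
open import Data.Rational as ℚ using (ℚ; 0ℚ)
open import Function.Definitions using (Injective)
open import Relation.Nullary using (does)
open import Relation.Binary.PropositionalEquality using (_≡_)

record Graph (n : ℕ) : Set where
  field
    adj   : Fin n → Fin n → Bool
    sym   : ∀ i j → adj i j ≡ adj j i
    irrefl : ∀ i → adj i i ≡ false
open Graph public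

_InducedIn_ : ∀ {k n} → Graph k → Graph n → Set
_InducedIn_ {k} {n} H G =
  ∃ λ (f : Fin k → Fin n) → Injective _≡_ _≡_ f ×
    (∀ i j → adj G (f i) (f j) ≡ adj H i j)

clawAdj : Fin 4 → Fin 4 → Bool
clawAdj Fin.zero Fin.zero = false
clawAdj Fin.zero (Fin.suc _) = true
clawAdj (Fin.suc _) Fin.zero = true
clawAdj (Fin.suc _) (Fin.suc _) = false

claw : Graph 4
claw = record { adj = clawAdj ; sym = s ; irrefl = r }
  where
  s : ∀ i j → clawAdj i j ≡ clawAdj j i
  s Fin.zero Fin.zero = _≡_.refl
  s Fin.zero (Fin.suc _) = _≡_.refl
  s (Fin.suc _) Fin.zero = _≡_.refl
  s (Fin.suc _) (Fin.suc _) = _≡_.refl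
  r : ∀ i → clawAdj i i ≡ false
  r Fin.zero = _≡_.refl
  r (Fin.suc _) = _≡_.refl

coDiamondAdj : Fin 4 → Fin 4 → Bool
coDiamondAdj Fin.zero (Fin.suc Fin.zero) = true
coDiamondAdj (Fin.suc Fin.zero) Fin.zero = true
coDiamondAdj _ _ = false

coDiamond : Graph 4
coDiamond = record { adj = coDiamondAdj ; sym = s ; irrefl = r }
  where
  s : ∀ i j → coDiamondAdj i j ≡ coDiamondAdj j i
  s Fin.zero Fin.zero = _≡_.refl
  s Fin.zero (Fin.suc Fin.zero) = _≡_.refl
  s Fin.zero (Fin.suc (Fin.suc _)) = _≡_.refl
  s (Fin.suc Fin.zero) Fin.zero = _≡_.refl
  s (Fin.suc (Fin.suc _)) Fin.zero = _≡_.refl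
  s (Fin.suc Fin.zero) (Fin.suc Fin.zero) = _≡_.refl
  s (Fin.suc Fin.zero) (Fin.suc (Fin.suc _)) = _≡_.refl
  s (Fin.suc (Fin.suc _)) (Fin.suc Fin.zero) = _≡_.refl
  s (Fin.suc (Fin.suc _)) (Fin.suc (Fin.suc _)) = _≡_.refl
  r : ∀ i → coDiamondAdj i i ≡ false
  r Fin.zero = _≡_.refl
  r (Fin.suc Fin.zero) = _≡_.refl
  r (Fin.suc (Fin.suc _)) = _≡_.refl

allB : ∀ {A : Set} → (A → Bool) → List A → Bool
allB p = foldr (λ x b → p x ∧ b) true

allSubsets : (m : ℕ) → List (Vec Bool m)
allSubsets zero = [ [] ]
allSubsets (suc m) = concatMap (λ s → (true ∷ s) ∷ (false ∷ s) ∷ []) (allSubsets m)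

allMaps : (m n : ℕ) → List (Vec (Fin m) n)
allMaps m zero = [ [] ]
allMaps m (suc n) = concatMap (λ i → map (i ∷_) (allMaps m n)) (allFin m)

card : ∀ {m} → Vec Bool m → ℕ
card = Vec.count (λ b → b Data.Bool.≟ true)
  where import Data.Bool

isStable : ∀ {n} → Graph n → Vec Bool n → Bool
isStable {n} G S =
  allB (λ i → allB (λ j → not (lookup S i ∧ lookup S j ∧ adj G i j)) (allFin n)) (allFin n)

α : ∀ {n} → Graph n → ℕ
α {n} G = foldr _⊔_ 0 (map card (filter (λ S → isStable G S Data.Bool.≟ true) (allSubsets n)))
  where import Data.Bool

-- Formal power series in x_1, x_2, ... with integer (here ℕ) coefficients
-- are described by their coefficients: a monomial involves finitely many
-- variables, so it is x^a for some m and exponent vector a : Vec ℕ m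
-- (exponents of x_1..x_m, all other exponents 0).

Monomials : Set
Monomials = (m : ℕ) → List (Vec ℕ m)
-- a series given as a multiset of monomials (each with coefficient 1),
-- listed for each m: all its monomials supported on x_1..x_m.

coeff : Monomials → (m : ℕ) → Vec ℕ m → ℕ
coeff F m a = length (filter (λ b → ≡-dec ℕ._≟_ b a) (F m))

-- X_G: one monomial per proper colouring κ : V → ℤ⁺; those whose monomial
-- involves only x_1..x_m are exactly the proper colourings into {1..m}.
isProper : ∀ {n m} → Graph n → Vec (Fin m) n → Bool
isProper {n} G κ =
  allB (λ i → allB (λ j → not (adj G i j ∧ does (lookup κ i Fin.≟ lookup κ j))) (allFin n)) (allFin n)

expo : ∀ {n m} → Vec (Fin m) n → Vec ℕ m
expo {n} {m} κ = Vec.tabulate (λ j → List.length (filter (λ v → lookup κ v Fin.≟ j) (allFin n)))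

X : ∀ {n} → Graph n → Monomials
X {n} G m = map expo (filter (λ κ → isProper G κ Data.Bool.≟ true) (allMaps m n))
  where import Data.Bool

e : ℕ → Monomials
e k m = map (Vec.map (λ b → if b then 1 else 0))
            (filter (λ S → card S ℕ.≟ k) (allSubsets m))

_⊗_ : Monomials → Monomials → Monomials
(F ⊗ H) m = concatMap (λ u → map (Vec.zipWith ℕ._+_ u) (H m)) (F m)

one : Monomials
one m = [ Vec.replicate m 0 ]

eλ : List ℕ → Monomials
eλ λs = foldr (λ k acc → e k ⊗ acc) one λs

IsPartition : List ℕ → Set
IsPartition λs = Linked _≥_ λs × All (0 <_) λs

ℕ→ℚ : ℕ → ℚ
ℕ→ℚ k = + k ℚ./ 1

combCoeff : List (List ℕ × ℚ) → (m : ℕ) → Vec ℕ m → ℚ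
combCoeff L m a = foldr (λ p acc → proj₂ p ℚ.* ℕ→ℚ (coeff (eλ (proj₁ p)) m a) ℚ.+ acc) 0ℚ L

EPositive : Monomials → Set
EPositive F = ∃ λ (L : List (List ℕ × ℚ)) →
  All (λ p → IsPartition (proj₁ p) × 0ℚ ℚ.≤ proj₂ p) L ×
  (∀ (m : ℕ) (a : Vec ℕ m) → ℕ→ℚ (coeff F m a) ≡ combCoeff L m a)

-- A graph G that is claw-free, co-diamond-free and has α(G) ≥ 4 has no
-- edges at all, so its chromatic symmetric function is e₁ⁿ = e_(1ⁿ).
--
-- Let a,b,c,d be a stable set of size four.  If some w were
-- adjacent to a, then either two of b,c,d are neighbours of w (a claw
-- centred at w) or two of them are not (a co-diamond on the edge wa and
-- those two).  Hence a, and likewise b, is isolated; but then any edge uv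
-- together with a,b would be a co-diamond.
--
-- In an edgeless graph on n vertices every colouring
-- is proper, so X_G lists the monomials of all maps Fin n → Fin m.  Writing
-- e₁ = Σ_i x_i as the list of unit vectors, the monomials of e₁ⁿ are the
-- same list up to permutation (induction on n, peeling off the colour of
-- the first vertex), so X_G = 1 · e_(1ⁿ) is e-positive.
module Submission where

open import Defs hiding (sym)
open import Data.Bool using (Bool; true; false; if_then_else_; not)
import Data.Bool as Bool
import Data.Bool.Properties as BoolP
open import Data.Nat as ℕ using (ℕ; zero; suc; _+_; _≤_; _⊔_; s≤s; z≤n)
import Data.Nat.Properties as ℕP
open import Data.Fin as Fin using (Fin)
open import Data.Fin.Patterns using (0F; 1F; 2F; 3F)
import Data.Fin.Properties as FinP
open import Data.Fin.Subset using (⁅_⁆) renaming (⊥ to ∅)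
open import Data.Vec as Vec using (Vec; lookup)
import Data.Vec.Properties as VecP
open import Data.List as List
  using (List; []; _∷_; [_]; _++_; map; concatMap; filter; length; allFin; foldr)
open import Data.List.Properties as ListP using ()
open import Data.List.Membership.Propositional using (_∈_)
open import Data.List.Membership.Propositional.Properties using (∈-filter⁻; ∈-allFin)
open import Data.List.Relation.Unary.Any using (here; there)
open import Data.List.Relation.Unary.All as All using (All; []; _∷_)
import Data.List.Relation.Unary.All.Properties as AllP
open import Data.List.Relation.Unary.Linked using (Linked; []; [-]; _∷_)
open import Data.List.Relation.Unary.AllPairs using ([]; _∷_)
open import Data.List.Relation.Unary.Unique.Propositional using (Unique)
import Data.List.Relation.Unary.Unique.Propositional.Properties as UniqueP
open import Data.List.Relation.Binary.Permutation.Propositional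
  using (_↭_; ↭-refl; ↭-sym; ↭-trans; ↭-reflexive; prep; swap; module PermutationReasoning)
  renaming (refl to ↭-refl-con; trans to ↭-trans-con)
open import Data.List.Relation.Binary.Permutation.Propositional.Properties
  using (++⁺; ++⁺ˡ; shift; shifts; map⁺; filter-↭; ↭-length)
open import Data.Product using (_×_; _,_; proj₂; ∃)
open import Data.Sum using (inj₁; inj₂)
open import Data.Empty using (⊥-elim) renaming (⊥ to False)
open import Data.Rational as ℚ using (1ℚ)
import Data.Rational.Properties as ℚP
import Data.Integer as ℤ
open import Function using (_∘_)
open import Function.Definitions using (Injective)
open import Relation.Nullary using (¬_; does)
open import Relation.Unary using (Pred; Decidable)
open import Relation.Binary.PropositionalEquality
  using (_≡_; _≢_; refl; sym; trans; cong; cong₂; subst; module ≡-Reasoning)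

allB⇒All : ∀ {A : Set} (p : A → Bool) xs → allB p xs ≡ true → All (λ x → p x ≡ true) xs
allB⇒All p []       _ = []
allB⇒All p (x ∷ xs) h with p x in px
... | true = px ∷ allB⇒All p xs h

All⇒allB : ∀ {A : Set} {p : A → Bool} {xs} → All (λ x → p x ≡ true) xs → allB p xs ≡ true
All⇒allB []         = refl
All⇒allB (px ∷ pxs) rewrite px = All⇒allB pxs

adjacent⇒distinct : ∀ {n} (G : Graph n) {x y} → adj G x y ≡ true → x ≢ y
adjacent⇒distinct G {x} xy refl with () ← trans (sym xy) (irrefl G x)

separated⇒distinct : ∀ {n} (G : Graph n) {x y z} →
  adj G x z ≡ true → adj G y z ≡ false → x ≢ y
separated⇒distinct G xz yz refl with () ← trans (sym xz) yz

quad : ∀ {n} → Fin n → Fin n → Fin n → Fin n → Fin 4 → Fin n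
quad a b c d 0F = a
quad a b c d 1F = b
quad a b c d 2F = c
quad a b c d 3F = d

quad-injective : ∀ {n} {a b c d : Fin n} →
  a ≢ b → a ≢ c → a ≢ d → b ≢ c → b ≢ d → c ≢ d → Injective _≡_ _≡_ (quad a b c d)
quad-injective ab ac ad bc bd cd = injective
  where
  injective : Injective _≡_ _≡_ _
  injective {0F} {0F} _ = refl
  injective {1F} {1F} _ = refl
  injective {2F} {2F} _ = refl
  injective {3F} {3F} _ = refl
  injective {0F} {1F} e = ⊥-elim (ab e)
  injective {0F} {2F} e = ⊥-elim (ac e)
  injective {0F} {3F} e = ⊥-elim (ad e)
  injective {1F} {2F} e = ⊥-elim (bc e)
  injective {1F} {3F} e = ⊥-elim (bd e)
  injective {2F} {3F} e = ⊥-elim (cd e)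
  injective {1F} {0F} e = ⊥-elim (ab (sym e))
  injective {2F} {0F} e = ⊥-elim (ac (sym e))
  injective {3F} {0F} e = ⊥-elim (ad (sym e))
  injective {2F} {1F} e = ⊥-elim (bc (sym e))
  injective {3F} {1F} e = ⊥-elim (bd (sym e))
  injective {3F} {2F} e = ⊥-elim (cd (sym e))

-- Agreement of the six pairs i < j suffices: the diagonal agrees by
-- irreflexivity and the pairs i > j by symmetry of both graphs.
quad-adj : ∀ {n} (G : Graph n) (H : Graph 4) {a b c d : Fin n} →
  adj G a b ≡ adj H 0F 1F → adj G a c ≡ adj H 0F 2F → adj G a d ≡ adj H 0F 3F →
  adj G b c ≡ adj H 1F 2F → adj G b d ≡ adj H 1F 3F → adj G c d ≡ adj H 2F 3F →
  ∀ i j → adj G (quad a b c d i) (quad a b c d j) ≡ adj H i j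
quad-adj G H {a} {b} {c} {d} ab ac ad bc bd cd = agree
  where
  flip : ∀ {x y i j} → adj G x y ≡ adj H i j → adj G y x ≡ adj H j i
  flip {x} {y} {i} {j} p = trans (Graph.sym G y x) (trans p (Graph.sym H i j))
  diagonal : ∀ x i → adj G x x ≡ adj H i i
  diagonal x i = trans (irrefl G x) (sym (irrefl H i))
  agree : ∀ i j → adj G (quad a b c d i) (quad a b c d j) ≡ adj H i j
  agree 0F 0F = diagonal a 0F
  agree 1F 1F = diagonal b 1F
  agree 2F 2F = diagonal c 2F
  agree 3F 3F = diagonal d 3F
  agree 0F 1F = ab
  agree 0F 2F = ac
  agree 0F 3F = ad
  agree 1F 2F = bc
  agree 1F 3F = bd
  agree 2F 3F = cd
  agree 1F 0F = flip ab
  agree 2F 0F = flip ac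
  agree 3F 0F = flip ad
  agree 2F 1F = flip bc
  agree 3F 1F = flip bd
  agree 3F 2F = flip cd

induced4 : ∀ {n} (G : Graph n) (H : Graph 4) {a b c d : Fin n} →
  a ≢ b → a ≢ c → a ≢ d → b ≢ c → b ≢ d → c ≢ d →
  adj G a b ≡ adj H 0F 1F → adj G a c ≡ adj H 0F 2F → adj G a d ≡ adj H 0F 3F →
  adj G b c ≡ adj H 1F 2F → adj G b d ≡ adj H 1F 3F → adj G c d ≡ adj H 2F 3F →
  H InducedIn G
induced4 G H a≢b a≢c a≢d b≢c b≢d c≢d ab ac ad bc bd cd =
  quad _ _ _ _ , quad-injective a≢b a≢c a≢d b≢c b≢d c≢d , quad-adj G H ab ac ad bc bd cd

members : ∀ {k} → Vec Bool k → List (Fin k)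
members Vec.[]          = []
members (true  Vec.∷ S) = Fin.zero ∷ map Fin.suc (members S)
members (false Vec.∷ S) = map Fin.suc (members S)

length-members : ∀ {k} (S : Vec Bool k) → length (members S) ≡ card S
length-members Vec.[]          = refl
length-members (true  Vec.∷ S) = cong suc (trans (ListP.length-map Fin.suc (members S)) (length-members S))
length-members (false Vec.∷ S) = trans (ListP.length-map Fin.suc (members S)) (length-members S)

members-∈ : ∀ {k} (S : Vec Bool k) → All (λ i → lookup S i ≡ true) (members S)
members-∈ Vec.[]          = []
members-∈ (true  Vec.∷ S) = refl ∷ AllP.map⁺ (members-∈ S)
members-∈ (false Vec.∷ S) = AllP.map⁺ (members-∈ S)

members-unique : ∀ {k} (S : Vec Bool k) → Unique (members S)
members-unique Vec.[]          = []
members-unique (true  Vec.∷ S) =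
  AllP.map⁺ (All.universal (λ _ ()) (members S)) ∷ UniqueP.map⁺ FinP.suc-injective (members-unique S)
members-unique (false Vec.∷ S) = UniqueP.map⁺ FinP.suc-injective (members-unique S)

stable⇒nonadjacent : ∀ {n} (G : Graph n) (S : Vec Bool n) → isStable G S ≡ true →
  ∀ {i j} → lookup S i ≡ true → lookup S j ≡ true → adj G i j ≡ false
stable⇒nonadjacent {n} G S stable {i} {j} i∈S j∈S = begin
  adj G i j                                         ≡⟨ BoolP.not-involutive (adj G i j) ⟨
  not (not (adj G i j))                             ≡⟨ cong not entry ⟩
  false                                             ∎
  where
  open ≡-Reasoning
  row : allB (λ j → not (lookup S i Bool.∧ lookup S j Bool.∧ adj G i j)) (allFin n) ≡ true
  row = All.lookup (allB⇒All _ (allFin n) stable) (∈-allFin i)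
  entry : not (adj G i j) ≡ true
  entry with All.lookup (allB⇒All _ (allFin n) row) (∈-allFin j)
  ... | e rewrite i∈S | j∈S = e

max-attained : ∀ {A : Set} (f : A → ℕ) (xs : List A) {k} →
  suc k ≤ foldr _⊔_ 0 (map f xs) → ∃ λ x → x ∈ xs × suc k ≤ f x
max-attained f (x ∷ xs) {k} h with ℕP.⊔-sel (f x) (foldr _⊔_ 0 (map f xs))
... | inj₁ eq = x , here refl , subst (suc k ≤_) eq h
... | inj₂ eq with max-attained f xs (subst (suc k ≤_) eq h)
...   | y , y∈xs , large = y , there y∈xs , large

large-stable-set : ∀ {n} (G : Graph n) {k} → suc k ≤ α G →
  ∃ λ S → isStable G S ≡ true × suc k ≤ card S
large-stable-set {n} G h with max-attained card _ h
... | S , S∈ , large = S , proj₂ (∈-filter⁻ (λ S → isStable G S Bool.≟ true) {xs = allSubsets n} S∈) , large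

module ClawAndCoDiamondFree {n} (G : Graph n)
  (claw-free : ¬ claw InducedIn G) (coDiamond-free : ¬ coDiamond InducedIn G) where

  Apart : Fin n → Fin n → Set
  Apart x y = x ≢ y × adj G x y ≡ false

  apart-sym : ∀ {x y} → Apart x y → Apart y x
  apart-sym {x} {y} (x≢y , xy) = (x≢y ∘ sym) , trans (Graph.sym G y x) xy

  no-claw : ∀ {c x y z} → adj G c x ≡ true → adj G c y ≡ true → adj G c z ≡ true →
    Apart x y → Apart x z → Apart y z → False
  no-claw cx cy cz (x≢y , xy) (x≢z , xz) (y≢z , yz) = claw-free
    (induced4 G claw (adjacent⇒distinct G cx) (adjacent⇒distinct G cy) (adjacent⇒distinct G cz)
       x≢y x≢z y≢z cx cy cz xy xz yz)

  no-coDiamond : ∀ {p q r s} → adj G p q ≡ true →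
    adj G p r ≡ false → adj G p s ≡ false → adj G q r ≡ false → adj G q s ≡ false →
    Apart r s → False
  no-coDiamond {p} {q} {r} {s} pq pr ps qr qs (r≢s , rs) = coDiamond-free
    (induced4 G coDiamond (adjacent⇒distinct G pq)
       (separated⇒distinct G pq (flip qr)) (separated⇒distinct G pq (flip qs))
       (separated⇒distinct G (flip pq) (flip pr)) (separated⇒distinct G (flip pq) (flip ps))
       r≢s pq pr ps qr qs rs)
    where
    flip : ∀ {x y b} → adj G x y ≡ b → adj G y x ≡ b
    flip {x} {y} e = trans (Graph.sym G y x) e

  record Stable4 : Set where
    field
      a b c d : Fin n
      ab : Apart a b
      ac : Apart a c
      ad : Apart a d
      bc : Apart b c
      bd : Apart b d
      cd : Apart c d

  swap-ab : Stable4 → Stable4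
  swap-ab Q = record
    { a = b ; b = a ; c = c ; d = d
    ; ab = apart-sym ab ; ac = bc ; ad = bd ; bc = ac ; bd = ad ; cd = cd }
    where open Stable4 Q

  stable4-isolated : (Q : Stable4) → ∀ w → adj G w (Stable4.a Q) ≡ false
  stable4-isolated Q w = BoolP.¬-not neighbour
    where
    open Stable4 Q
    neighbour : adj G w a ≡ true → False
    neighbour wa with adj G w b in wb | adj G w c in wc | adj G w d in wd
    ... | true  | true  | _     = no-claw wa wb wc ab ac bc
    ... | true  | false | true  = no-claw wa wb wd ab ad bd
    ... | false | true  | true  = no-claw wa wc wd ac ad cd
    ... | true  | false | false = no-coDiamond wa wc wd (proj₂ ac) (proj₂ ad) cd
    ... | false | true  | false = no-coDiamond wa wb wd (proj₂ ab) (proj₂ ad) bd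
    ... | false | false | _     = no-coDiamond wa wb wc (proj₂ ab) (proj₂ ac) bc

  -- With a and b isolated, an edge uv would form a co-diamond with a, b.
  stable4⇒edgeless : Stable4 → ∀ u v → adj G u v ≡ false
  stable4⇒edgeless Q u v = BoolP.¬-not λ uv →
    no-coDiamond uv (isolated-a u) (isolated-b u) (isolated-a v) (isolated-b v) ab
    where
    open Stable4 Q
    isolated-a : ∀ w → adj G w a ≡ false
    isolated-a = stable4-isolated Q
    isolated-b : ∀ w → adj G w b ≡ false
    isolated-b = stable4-isolated (swap-ab Q)

  stable4 : (S : Vec Bool n) → isStable G S ≡ true →
    ∀ xs → 4 ≤ length xs → All (λ i → lookup S i ≡ true) xs → Unique xs → Stable4
  stable4 S stable []                    ()                      _ _
  stable4 S stable (_ ∷ [])              (s≤s ())                _ _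
  stable4 S stable (_ ∷ _ ∷ [])          (s≤s (s≤s ()))          _ _
  stable4 S stable (_ ∷ _ ∷ _ ∷ [])      (s≤s (s≤s (s≤s ())))    _ _
  stable4 S stable (a ∷ b ∷ c ∷ d ∷ _) _ (a∈ ∷ b∈ ∷ c∈ ∷ d∈ ∷ _)
    ((a≢b ∷ a≢c ∷ a≢d ∷ _) ∷ (b≢c ∷ b≢d ∷ _) ∷ (c≢d ∷ _) ∷ _) = record
    { a = a ; b = b ; c = c ; d = d
    ; ab = a≢b , nonadj a∈ b∈ ; ac = a≢c , nonadj a∈ c∈ ; ad = a≢d , nonadj a∈ d∈
    ; bc = b≢c , nonadj b∈ c∈ ; bd = b≢d , nonadj b∈ d∈ ; cd = c≢d , nonadj c∈ d∈ }
    where nonadj = stable⇒nonadjacent G S stable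

  edgeless : 4 ≤ α G → ∀ u v → adj G u v ≡ false
  edgeless h with large-stable-set G h
  ... | S , stable , large = stable4⇒edgeless
    (stable4 S stable (members S) (subst (4 ≤_) (sym (length-members S)) large)
       (members-∈ S) (members-unique S))

concatMap-↭ˡ : ∀ {A B : Set} {f g : A → List B} → (∀ x → f x ↭ g x) →
  ∀ xs → concatMap f xs ↭ concatMap g xs
concatMap-↭ˡ f↭g []       = ↭-refl
concatMap-↭ˡ f↭g (x ∷ xs) = ++⁺ (f↭g x) (concatMap-↭ˡ f↭g xs)

concatMap-↭ʳ : ∀ {A B : Set} (f : A → List B) {xs ys} → xs ↭ ys →
  concatMap f xs ↭ concatMap f ys
concatMap-↭ʳ f ↭-refl-con          = ↭-refl
concatMap-↭ʳ f (prep x p)          = ++⁺ˡ (f x) (concatMap-↭ʳ f p)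
concatMap-↭ʳ f (swap x y p)        = ↭-trans (shifts (f x) (f y)) (++⁺ˡ (f y) (++⁺ˡ (f x) (concatMap-↭ʳ f p)))
concatMap-↭ʳ f (↭-trans-con p q)   = ↭-trans (concatMap-↭ʳ f p) (concatMap-↭ʳ f q)

extend : ∀ {m} → Vec Bool m → List (Vec Bool (suc m))
extend s = (true Vec.∷ s) ∷ (false Vec.∷ s) ∷ []

filter-extend : ∀ {m p} {P : Pred (Vec Bool (suc m)) p} (P? : Decidable P) xs →
  filter P? (concatMap extend xs) ↭
  map (true Vec.∷_) (filter (P? ∘ (true Vec.∷_)) xs) ++ map (false Vec.∷_) (filter (P? ∘ (false Vec.∷_)) xs)
filter-extend P? [] = ↭-refl
filter-extend P? (x ∷ xs) with does (P? (true Vec.∷ x))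
... | true with does (P? (false Vec.∷ x))
...   | true  = prep _ (↭-trans (prep _ (filter-extend P? xs)) (↭-sym (shift _ (map _ (filter _ xs)) _)))
...   | false = prep _ (filter-extend P? xs)
filter-extend P? (x ∷ xs) | false with does (P? (false Vec.∷ x))
...   | true  = ↭-trans (prep _ (filter-extend P? xs)) (↭-sym (shift _ (map _ (filter _ xs)) _))
...   | false = filter-extend P? xs

subsets-of-size-0 : ∀ m → filter (λ S → card S ℕ.≟ 0) (allSubsets m) ↭ [ ∅ ]
subsets-of-size-0 zero    = ↭-refl
subsets-of-size-0 (suc m) = begin
  filter (λ S → card S ℕ.≟ 0) (allSubsets (suc m))
    ↭⟨ filter-extend (λ S → card S ℕ.≟ 0) (allSubsets m) ⟩
  map (true Vec.∷_) (filter (λ S → suc (card S) ℕ.≟ 0) (allSubsets m)) ++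
  map (false Vec.∷_) (filter (λ S → card S ℕ.≟ 0) (allSubsets m))
    ≡⟨ cong₂ _++_ (cong (map (true Vec.∷_)) (ListP.filter-none _ (All.universal (λ _ ()) (allSubsets m)))) refl ⟩
  map (false Vec.∷_) (filter (λ S → card S ℕ.≟ 0) (allSubsets m))
    ↭⟨ map⁺ _ (subsets-of-size-0 m) ⟩
  [ ∅ ] ∎
  where open PermutationReasoning

subsets-of-size-1 : ∀ m → filter (λ S → card S ℕ.≟ 1) (allSubsets m) ↭ map ⁅_⁆ (allFin m)
subsets-of-size-1 zero    = ↭-refl
subsets-of-size-1 (suc m) = begin
  filter (λ S → card S ℕ.≟ 1) (allSubsets (suc m))
    ↭⟨ filter-extend (λ S → card S ℕ.≟ 1) (allSubsets m) ⟩
  map (true Vec.∷_) (filter (λ S → suc (card S) ℕ.≟ 1) (allSubsets m)) ++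
  map (false Vec.∷_) (filter (λ S → card S ℕ.≟ 1) (allSubsets m))
    ≡⟨ cong₂ _++_ (cong (map (true Vec.∷_)) (ListP.filter-≐ _ _ (ℕP.suc-injective , cong suc) (allSubsets m))) refl ⟩
  map (true Vec.∷_) (filter (λ S → card S ℕ.≟ 0) (allSubsets m)) ++
  map (false Vec.∷_) (filter (λ S → card S ℕ.≟ 1) (allSubsets m))
    ↭⟨ ++⁺ (map⁺ _ (subsets-of-size-0 m)) (map⁺ _ (subsets-of-size-1 m)) ⟩
  ⁅ Fin.zero ⁆ ∷ map (false Vec.∷_) (map ⁅_⁆ (allFin m))
    ≡⟨ cong (⁅ Fin.zero ⁆ ∷_) (ListP.map-∘ (allFin m)) ⟨
  ⁅ Fin.zero ⁆ ∷ map (⁅_⁆ ∘ Fin.suc) (allFin m)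
    ≡⟨ cong (⁅ Fin.zero ⁆ ∷_) (trans (ListP.map-tabulate (λ i → i) _) (sym (ListP.map-tabulate Fin.suc ⁅_⁆))) ⟩
  map ⁅_⁆ (allFin (suc m)) ∎
  where open PermutationReasoning

tabulate-const : ∀ {A : Set} m (x : A) → Vec.tabulate {n = m} (λ _ → x) ≡ Vec.replicate m x
tabulate-const zero    x = refl
tabulate-const (suc m) x = cong (x Vec.∷_) (tabulate-const m x)

indicator : ∀ {m} → Vec Bool m → Vec ℕ m
indicator = Vec.map (λ b → if b then 1 else 0)

unit : ∀ {m} → Fin m → Vec ℕ m
unit i = Vec.tabulate (λ j → if does (i Fin.≟ j) then 1 else 0)

indicator-singleton : ∀ {m} (i : Fin m) → indicator ⁅ i ⁆ ≡ unit i
indicator-singleton {suc m} Fin.zero    = cong (1 Vec.∷_) (begin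
  indicator (Vec.replicate m false)          ≡⟨ VecP.map-replicate _ false m ⟩
  Vec.replicate m 0                           ≡⟨ tabulate-const m 0 ⟨
  Vec.tabulate (λ _ → 0)                      ∎)
  where open ≡-Reasoning
indicator-singleton {suc m} (Fin.suc i) = cong (0 Vec.∷_) (indicator-singleton i)

e₁↭units : ∀ m → e 1 m ↭ map unit (allFin m)
e₁↭units m = begin
  map indicator (filter (λ S → card S ℕ.≟ 1) (allSubsets m)) ↭⟨ map⁺ indicator (subsets-of-size-1 m) ⟩
  map indicator (map ⁅_⁆ (allFin m))                          ≡⟨ ListP.map-∘ (allFin m) ⟨
  map (indicator ∘ ⁅_⁆) (allFin m)                            ≡⟨ ListP.map-cong indicator-singleton (allFin m) ⟩
  map unit (allFin m)                                         ∎
  where open PermutationReasoning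

length-filter-tabulate : ∀ {A : Set} {p} {P : Pred A p} (P? : Decidable P) {k} (f : Fin k → A) →
  length (filter P? (List.tabulate f)) ≡ length (filter (P? ∘ f) (allFin k))
length-filter-tabulate P? {zero}  f = refl
length-filter-tabulate P? {suc k} f with does (P? (f Fin.zero))
... | true  = cong suc (trans (length-filter-tabulate P? (f ∘ Fin.suc)) (sym (length-filter-tabulate (P? ∘ f) Fin.suc)))
... | false = trans (length-filter-tabulate P? (f ∘ Fin.suc)) (sym (length-filter-tabulate (P? ∘ f) Fin.suc))

zipWith-tabulate : ∀ {m} (f g : Fin m → ℕ) →
  Vec.zipWith _+_ (Vec.tabulate f) (Vec.tabulate g) ≡ Vec.tabulate (λ j → f j + g j)
zipWith-tabulate {zero}  f g = refl
zipWith-tabulate {suc m} f g = cong (f Fin.zero + g Fin.zero Vec.∷_) (zipWith-tabulate (f ∘ Fin.suc) (g ∘ Fin.suc))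

expo-∷ : ∀ {n m} (i : Fin m) (κ : Vec (Fin m) n) → expo (i Vec.∷ κ) ≡ Vec.zipWith _+_ (unit i) (expo κ)
expo-∷ {n} i κ = sym (trans (zipWith-tabulate _ _) (VecP.tabulate-cong count))
  where
  count : ∀ j → (if does (i Fin.≟ j) then 1 else 0) + length (filter (λ v → lookup κ v Fin.≟ j) (allFin n))
              ≡ length (filter (λ v → lookup (i Vec.∷ κ) v Fin.≟ j) (allFin (suc n)))
  count j with does (i Fin.≟ j)
  ... | true  = cong suc (sym (length-filter-tabulate (λ v → lookup (i Vec.∷ κ) v Fin.≟ j) Fin.suc))
  ... | false = sym (length-filter-tabulate (λ v → lookup (i Vec.∷ κ) v Fin.≟ j) Fin.suc)

colourings : ∀ m n → List (Vec ℕ m)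
colourings m n = map expo (allMaps m n)

first-colour : ∀ {m} n (i : Fin m) →
  map expo (map (i Vec.∷_) (allMaps m n)) ≡ map (Vec.zipWith _+_ (unit i)) (colourings m n)
first-colour {m} n i = begin
  map expo (map (i Vec.∷_) (allMaps m n))              ≡⟨ ListP.map-∘ (allMaps m n) ⟨
  map (expo ∘ (i Vec.∷_)) (allMaps m n)                ≡⟨ ListP.map-cong (expo-∷ i) (allMaps m n) ⟩
  map (Vec.zipWith _+_ (unit i) ∘ expo) (allMaps m n)  ≡⟨ ListP.map-∘ (allMaps m n) ⟩
  map (Vec.zipWith _+_ (unit i)) (colourings m n)      ∎
  where open ≡-Reasoning

e₁-power↭colourings : ∀ n m → eλ (List.replicate n 1) m ↭ colourings m n
e₁-power↭colourings zero    m = ↭-reflexive (cong [_] (sym (tabulate-const m 0)))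
e₁-power↭colourings (suc n) m = begin
  concatMap (λ u → map (Vec.zipWith _+_ u) (eλ (List.replicate n 1) m)) (e 1 m)
    ↭⟨ concatMap-↭ˡ (λ u → map⁺ _ (e₁-power↭colourings n m)) (e 1 m) ⟩
  concatMap (λ u → map (Vec.zipWith _+_ u) (colourings m n)) (e 1 m)
    ↭⟨ concatMap-↭ʳ _ (e₁↭units m) ⟩
  concatMap (λ u → map (Vec.zipWith _+_ u) (colourings m n)) (map unit (allFin m))
    ≡⟨ ListP.concatMap-map _ unit (allFin m) ⟩
  concatMap (λ i → map (Vec.zipWith _+_ (unit i)) (map expo (allMaps m n))) (allFin m)
    ≡⟨ ListP.concatMap-cong (first-colour n) (allFin m) ⟨
  concatMap (λ i → map expo (map (i Vec.∷_) (allMaps m n))) (allFin m)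
    ≡⟨ ListP.map-concatMap expo (λ i → map (i Vec.∷_) (allMaps m n)) (allFin m) ⟨
  colourings m (suc n) ∎
  where open PermutationReasoning

↭eλ⇒EPositive : ∀ (F : Monomials) (λs : List ℕ) → IsPartition λs →
  (∀ m → F m ↭ eλ λs m) → EPositive F
↭eλ⇒EPositive F λs partition F↭eλ =
  [ (λs , 1ℚ) ] , (partition , ℚ.*≤* (ℤ.+≤+ z≤n)) ∷ [] , λ m a → begin
    ℕ→ℚ (coeff F m a)                       ≡⟨ cong ℕ→ℚ (↭-length (filter-↭ (≟a a) (F↭eλ m))) ⟩
    ℕ→ℚ (coeff (eλ λs) m a)                 ≡⟨ ℚP.*-identityˡ _ ⟨
    1ℚ ℚ.* ℕ→ℚ (coeff (eλ λs) m a)          ≡⟨ ℚP.+-identityʳ _ ⟨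
    combCoeff [ (λs , 1ℚ) ] m a             ∎
  where
  open ≡-Reasoning
  ≟a : ∀ {m} (a : Vec ℕ m) → Decidable (_≡ a)
  ≟a a b = VecP.≡-dec ℕ._≟_ b a

ones-partition : ∀ n → IsPartition (List.replicate n 1)
ones-partition n = decreasing n , AllP.replicate⁺ n (s≤s z≤n)
  where
  decreasing : ∀ n → Linked ℕ._≥_ (List.replicate n 1)
  decreasing zero          = []
  decreasing (suc zero)    = [-]
  decreasing (suc (suc n)) = ℕP.≤-refl ∷ decreasing (suc n)

X-edgeless : ∀ {n} (G : Graph n) → (∀ u v → adj G u v ≡ false) → ∀ m → X G m ≡ colourings m n
X-edgeless {n} G no-edge m =
  cong (map expo) (ListP.filter-all (λ κ → isProper G κ Bool.≟ true) (All.universal proper (allMaps m n)))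
  where
  proper : ∀ κ → isProper G κ ≡ true
  proper κ = All⇒allB (All.universal (λ u → All⇒allB (All.universal (λ v →
    cong (λ b → not (b Bool.∧ _)) (no-edge u v)) (allFin n))) (allFin n))

-- The graph is edgeless, so X_G = e_(1ⁿ).
lemma10 : ∀ {n : ℕ} (G : Graph n) →
    ¬ (claw InducedIn G) → ¬ (coDiamond InducedIn G) → 4 ≤ α G →
    EPositive (X G)
lemma10 {n} G claw-free coDiamond-free large-α =
  ↭eλ⇒EPositive (X G) (List.replicate n 1) (ones-partition n) λ m → begin
    X G m                              ≡⟨ X-edgeless G no-edge m ⟩
    colourings m n                     ↭⟨ e₁-power↭colourings n m ⟨
    eλ (List.replicate n 1) m          ∎
  where
  open PermutationReasoning
  no-edge : ∀ u v → adj G u v ≡ false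
  no-edge = ClawAndCoDiamondFree.edgeless G claw-free coDiamond-free large-α
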